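{- Let $\langle A,N\rangle$ be a complete N4-structure and $\|\cdot\|$ a truth-value assignment on $\mathcal{L}_{\langle A,N\rangle}$ as in the context. Then for all $u,v\in\mathbf{V}^{\langle A,N\rangle}$ and every formula $\phi$, $\|u\approx v\|\leq\|\phi(u)\|\to\|\phi(v)\|$ (Leibniz law).
   Context: An N4-structure is $\langle A,\{N_x\}_{x\in A}\rangle$ where $A$ is a generalized Heyting algebra (distributive lattice with top $1$ and $\to$ with $x\wedge y\leq z$ iff $x\leq y\to z$) and $N_x\subseteq A$ with: (i) $N_x\neq\emptyset$; (ii) for $x'\in N_x,y'\in N_y$: $x'\vee y'\in N_{x\wedge y}$, $x'\wedge y'\in N_{x\vee y}$, $x\in N_{x'}$; (iii) for $y'\in N_y$: $x\wedge y'\in N_{x\to y}$. It is complete if $A$ is a complete lattice. Fix a model $\mathbf V$ of set theory; $\mathbf{V}^{\langle A,N\rangle}_\xi=\{x: x$ a function, $ran(x)\subseteq A$, $dom(x)\subseteq\mathbf{V}^{\langle A,N\rangle}_\zeta$ for some $\zeta<\xi\}$, $\mathbf{V}^{\langle A,N\rangle}=\bigcup_\xi\mathbf{V}^{\langle A,N\rangle}_\xi$. $\mathcal{L}_{\langle A,N\rangle}$ is the first-order language with connectives $\to,\wedge,\vee,\neg$, predicates $\in,\approx$, and constants for all names. A truth-value assignment is a map $\|\cdot\|$ from closed formulas to $A$ with: $\|u\in v\|=\bigvee_{x\in dom(v)}(v(x)\wedge\|x\approx u\|)$; $\|u\approx v\|=\bigwedge_{x\in dom(u)}(u(x)\to\|x\in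 v\|)\wedge\bigwedge_{x\in dom(v)}(v(x)\to\|x\in u\|)$; $\|\varphi\#\psi\|=\|\varphi\|\#\|\psi\|$ for $\#\in\{\wedge,\vee,\to\}$; $\|\neg\varphi\|\in N_{\|\varphi\|}$, $\|\neg\neg\varphi\|=\|\varphi\|$; $\|\neg(\varphi\vee\psi)\|=\|\neg\varphi\|\wedge\|\neg\psi\|$; $\|\neg(\varphi\wedge\psi)\|=\|\neg\varphi\|\vee\|\neg\psi\|$; $\|\neg(\varphi\to\psi)\|=\|\varphi\|\wedge\|\neg\psi\|$; $\|\exists x\varphi\|=\bigvee_{u}\|\varphi(u)\|$, $\|\forall x\varphi\|=\bigwedge_u\|\varphi(u)\|$ over $u\in\mathbf{V}^{\langle A,N\rangle}$; and $\|u\approx v\|\leq\|\neg\phi(u)\|\to\|\neg\phi(v)\|$ for every formula $\phi$. -}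

module Defs where

open import Level using (Level; _⊔_; suc; Lift; lift)
open import Data.Nat using (ℕ; zero) renaming (suc to sucℕ)
open import Data.Fin using (Fin; zero) renaming (suc to sucF)
open import Data.Product using (Σ)
open import Relation.Binary.Core using (Rel)
open import Relation.Binary.Structures using (IsPartialOrder)
open import Relation.Binary.PropositionalEquality using (_≡_)

-- N x y  means  y ∈ N_x.

record CompleteN4 (c ℓ ι : Level) : Set (suc (c ⊔ ℓ ⊔ ι)) where
  infixr 6 _∨_
  infixr 7 _∧_
  infixr 5 _⇒_
  infix 4 _≤_
  field
    Carrier        : Set c
    _≤_            : Rel Carrier ℓ
    isPartialOrder : IsPartialOrder _≡_ _≤_
    _∧_ _∨_ _⇒_    : Carrier → Carrier → Carrier
    ⊤              : Carrier
    ∧-lb₁  : ∀ x y → x ∧ y ≤ x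
    ∧-lb₂  : ∀ x y → x ∧ y ≤ y
    ∧-glb  : ∀ {x y z} → z ≤ x → z ≤ y → z ≤ x ∧ y
    ∨-ub₁  : ∀ x y → x ≤ x ∨ y
    ∨-ub₂  : ∀ x y → y ≤ x ∨ y
    ∨-lub  : ∀ {x y z} → x ≤ z → y ≤ z → x ∨ y ≤ z
    ⊤-max  : ∀ x → x ≤ ⊤
    distrib : ∀ x y z → x ∧ (y ∨ z) ≡ (x ∧ y) ∨ (x ∧ z)
    residuate   : ∀ {x y z} → x ∧ y ≤ z → x ≤ y ⇒ z
    unresiduate : ∀ {x y z} → x ≤ y ⇒ z → x ∧ y ≤ z
    ⋁ ⋀    : {I : Set ι} → (I → Carrier) → Carrier
    ⋁-ub   : ∀ {I : Set ι} (f : I → Carrier) i → f i ≤ ⋁ f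
    ⋁-lub  : ∀ {I : Set ι} (f : I → Carrier) {z} → (∀ i → f i ≤ z) → ⋁ f ≤ z
    ⋀-lb   : ∀ {I : Set ι} (f : I → Carrier) i → ⋀ f ≤ f i
    ⋀-glb  : ∀ {I : Set ι} (f : I → Carrier) {z} → (∀ i → z ≤ f i) → z ≤ ⋀ f
    N        : Carrier → Carrier → Set ℓ
    N-nonempty : ∀ x → Σ Carrier (N x)
    N-∧      : ∀ {x y x′ y′} → N x x′ → N y y′ → N (x ∧ y) (x′ ∨ y′)
    N-∨      : ∀ {x y x′ y′} → N x x′ → N y y′ → N (x ∨ y) (x′ ∧ y′)
    N-sym    : ∀ {x x′} → N x x′ → N x′ x
    N-⇒      : ∀ {x y y′} → N y y′ → N (x ⇒ y) (x ∧ y′)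

-- Names V^(A,N): well-founded "functions" from a (κ-small) family of
-- names to the carrier.

data Name {c} (κ : Level) (C : Set c) : Set (c ⊔ suc κ) where
  mk : (I : Set κ) → (I → Name κ C) → (I → C) → Name κ C

module _ {c} {κ : Level} {C : Set c} where

  Dom : Name κ C → Set κ
  Dom (mk I _ _) = I

  elt : (u : Name κ C) → Dom u → Name κ C
  elt (mk _ f _) = f

  val : (u : Name κ C) → Dom u → C
  val (mk _ _ g) = g

-- The language L_(A,N): de Bruijn variables, constants for all names.

data Tm {c} (κ : Level) (C : Set c) (n : ℕ) : Set (c ⊔ suc κ) where
  var : Fin n → Tm κ C n
  con : Name κ C → Tm κ C n

infix  8 _∈′_ _≈′_
infixr 6 _∨′_
infixr 7 _∧′_
infixr 5 _⇒′_

data Fm {c} (κ : Level) (C : Set c) (n : ℕ) : Set (c ⊔ suc κ) where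
  _∈′_ _≈′_       : Tm κ C n → Tm κ C n → Fm κ C n
  _∧′_ _∨′_ _⇒′_  : Fm κ C n → Fm κ C n → Fm κ C n
  ¬′_             : Fm κ C n → Fm κ C n
  ∃′ ∀′           : Fm κ C (sucℕ n) → Fm κ C n

module _ {c} {κ : Level} {C : Set c} where

  wkTm : ∀ {n} → Tm κ C n → Tm κ C (sucℕ n)
  wkTm (var i) = var (sucF i)
  wkTm (con u) = con u

  ext : ∀ {m n} → (Fin m → Tm κ C n) → Fin (sucℕ m) → Tm κ C (sucℕ n)
  ext σ zero     = var zero
  ext σ (sucF i) = wkTm (σ i)

  substTm : ∀ {m n} → Tm κ C m → (Fin m → Tm κ C n) → Tm κ C n
  substTm (var i) σ = σ i
  substTm (con u) σ = con u

  subst : ∀ {m n} → Fm κ C m → (Fin m → Tm κ C n) → Fm κ C n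
  subst (s ∈′ t) σ = substTm s σ ∈′ substTm t σ
  subst (s ≈′ t) σ = substTm s σ ≈′ substTm t σ
  subst (φ ∧′ ψ) σ = subst φ σ ∧′ subst ψ σ
  subst (φ ∨′ ψ) σ = subst φ σ ∨′ subst ψ σ
  subst (φ ⇒′ ψ) σ = subst φ σ ⇒′ subst ψ σ
  subst (¬′ φ)   σ = ¬′ (subst φ σ)
  subst (∃′ φ)   σ = ∃′ (subst φ (ext σ))
  subst (∀′ φ)   σ = ∀′ (subst φ (ext σ))

  _[_] : ∀ {n} → Fm κ C (sucℕ n) → Name κ C → Fm κ C n
  φ [ u ] = subst φ (λ { zero → con u ; (sucF i) → var i })

record TruthValueAssignment {c ℓ κ} (S : CompleteN4 c ℓ (c ⊔ suc κ))
       : Set (suc (c ⊔ ℓ ⊔ κ)) where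
  open CompleteN4 S
  field
    ‖_‖ : Fm κ Carrier 0 → Carrier
    ‖∈‖ : ∀ u v → ‖ con u ∈′ con v ‖
            ≡ ⋁ (λ (i : Lift (c ⊔ suc κ) (Dom v)) →
                   val v (Level.lower i) ∧ ‖ con (elt v (Level.lower i)) ≈′ con u ‖)
    ‖≈‖ : ∀ u v → ‖ con u ≈′ con v ‖
            ≡ ⋀ (λ (i : Lift (c ⊔ suc κ) (Dom u)) →
                   val u (Level.lower i) ⇒ ‖ con (elt u (Level.lower i)) ∈′ con v ‖)
              ∧ ⋀ (λ (i : Lift (c ⊔ suc κ) (Dom v)) →
                   val v (Level.lower i) ⇒ ‖ con (elt v (Level.lower i)) ∈′ con u ‖)
    ‖∧‖ : ∀ φ ψ → ‖ φ ∧′ ψ ‖ ≡ ‖ φ ‖ ∧ ‖ ψ ‖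
    ‖∨‖ : ∀ φ ψ → ‖ φ ∨′ ψ ‖ ≡ ‖ φ ‖ ∨ ‖ ψ ‖
    ‖⇒‖ : ∀ φ ψ → ‖ φ ⇒′ ψ ‖ ≡ ‖ φ ‖ ⇒ ‖ ψ ‖
    ‖¬‖∈N : ∀ φ → N ‖ φ ‖ ‖ ¬′ φ ‖
    ‖¬¬‖  : ∀ φ → ‖ ¬′ ¬′ φ ‖ ≡ ‖ φ ‖
    ‖¬∨‖  : ∀ φ ψ → ‖ ¬′ (φ ∨′ ψ) ‖ ≡ ‖ ¬′ φ ‖ ∧ ‖ ¬′ ψ ‖
    ‖¬∧‖  : ∀ φ ψ → ‖ ¬′ (φ ∧′ ψ) ‖ ≡ ‖ ¬′ φ ‖ ∨ ‖ ¬′ ψ ‖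
    ‖¬⇒‖  : ∀ φ ψ → ‖ ¬′ (φ ⇒′ ψ) ‖ ≡ ‖ φ ‖ ∧ ‖ ¬′ ψ ‖
    ‖∃‖   : ∀ φ → ‖ ∃′ φ ‖ ≡ ⋁ (λ (u : Name κ Carrier) → ‖ φ [ u ] ‖)
    ‖∀‖   : ∀ φ → ‖ ∀′ φ ‖ ≡ ⋀ (λ (u : Name κ Carrier) → ‖ φ [ u ] ‖)
    ‖¬‖-leibniz : ∀ u v (φ : Fm κ Carrier 1) →
                  ‖ con u ≈′ con v ‖ ≤ (‖ ¬′ (φ [ u ]) ‖ ⇒ ‖ ¬′ (φ [ v ]) ‖)

-- By induction on φ, generalised to formulas whose free variables are each
-- instantiated either by a fixed name or by the name being replaced.  Atomic formulas
-- reduce to ≈ being an equivalence that ∈ respects on both sides, which follows from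
-- the defining equations of ‖∈‖ and ‖≈‖ by recursion on names.  Relative to a fixed
-- lower bound z, "z ≤ p ⇒ p′" is preserved by ∧, ∨, ⋁, ⋀ and (contravariantly in
-- the antecedent, where symmetry of ≈ is used) by ⇒.  Negation is not monotone; that
-- case is exactly the Leibniz law for negated formulas postulated of the assignment.

module Submission where

open import Level using (Level; _⊔_; suc; Lift; lift; lower)
open import Data.Nat using () renaming (suc to sucℕ)
open import Data.Fin using (Fin; zero) renaming (suc to sucF)
open import Data.Vec.Functional using ([]; _∷_)
open import Function using (_∘_)
open import Relation.Binary.Structures using (IsPartialOrder)
open import Relation.Binary.PropositionalEquality
  using (_≡_; refl; sym; trans; cong; cong₂; module ≡-Reasoning)
open import Defs

module Substitution {c} {κ : Level} {C : Set c} where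

  ext-cong : ∀ {m n} {σ τ : Fin m → Tm κ C n} →
             (∀ i → σ i ≡ τ i) → ∀ i → ext σ i ≡ ext τ i
  ext-cong σ≗τ zero     = refl
  ext-cong σ≗τ (sucF i) = cong wkTm (σ≗τ i)

  substTm-cong : ∀ {m n} (t : Tm κ C m) {σ τ : Fin m → Tm κ C n} →
                 (∀ i → σ i ≡ τ i) → substTm t σ ≡ substTm t τ
  substTm-cong (var i) σ≗τ = σ≗τ i
  substTm-cong (con u) σ≗τ = refl

  subst-cong : ∀ {m n} (φ : Fm κ C m) {σ τ : Fin m → Tm κ C n} →
               (∀ i → σ i ≡ τ i) → subst φ σ ≡ subst φ τ
  subst-cong (s ∈′ t) h = cong₂ _∈′_ (substTm-cong s h) (substTm-cong t h)
  subst-cong (s ≈′ t) h = cong₂ _≈′_ (substTm-cong s h) (substTm-cong t h)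
  subst-cong (φ ∧′ ψ) h = cong₂ _∧′_ (subst-cong φ h) (subst-cong ψ h)
  subst-cong (φ ∨′ ψ) h = cong₂ _∨′_ (subst-cong φ h) (subst-cong ψ h)
  subst-cong (φ ⇒′ ψ) h = cong₂ _⇒′_ (subst-cong φ h) (subst-cong ψ h)
  subst-cong (¬′ φ)   h = cong ¬′_ (subst-cong φ h)
  subst-cong (∃′ φ)   h = cong ∃′ (subst-cong φ (ext-cong h))
  subst-cong (∀′ φ)   h = cong ∀′ (subst-cong φ (ext-cong h))

  substTm-wkTm-ext : ∀ {m n} (t : Tm κ C m) (τ : Fin m → Tm κ C n) →
                     substTm (wkTm t) (ext τ) ≡ wkTm (substTm t τ)
  substTm-wkTm-ext (var i) τ = refl
  substTm-wkTm-ext (con u) τ = refl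

  substTm-ext-comp : ∀ {l m n} (σ : Fin l → Tm κ C m) (τ : Fin m → Tm κ C n) i →
                     substTm (ext σ i) (ext τ) ≡ ext (λ j → substTm (σ j) τ) i
  substTm-ext-comp σ τ zero     = refl
  substTm-ext-comp σ τ (sucF i) = substTm-wkTm-ext (σ i) τ

  substTm-comp : ∀ {l m n} (t : Tm κ C l) (σ : Fin l → Tm κ C m) (τ : Fin m → Tm κ C n) →
                 substTm (substTm t σ) τ ≡ substTm t (λ i → substTm (σ i) τ)
  substTm-comp (var i) σ τ = refl
  substTm-comp (con u) σ τ = refl

  subst-comp : ∀ {l m n} (φ : Fm κ C l) (σ : Fin l → Tm κ C m) (τ : Fin m → Tm κ C n) →
               subst (subst φ σ) τ ≡ subst φ (λ i → substTm (σ i) τ)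
  subst-comp (s ∈′ t) σ τ = cong₂ _∈′_ (substTm-comp s σ τ) (substTm-comp t σ τ)
  subst-comp (s ≈′ t) σ τ = cong₂ _≈′_ (substTm-comp s σ τ) (substTm-comp t σ τ)
  subst-comp (φ ∧′ ψ) σ τ = cong₂ _∧′_ (subst-comp φ σ τ) (subst-comp ψ σ τ)
  subst-comp (φ ∨′ ψ) σ τ = cong₂ _∨′_ (subst-comp φ σ τ) (subst-comp ψ σ τ)
  subst-comp (φ ⇒′ ψ) σ τ = cong₂ _⇒′_ (subst-comp φ σ τ) (subst-comp ψ σ τ)
  subst-comp (¬′ φ)   σ τ = cong ¬′_ (subst-comp φ σ τ)
  subst-comp (∃′ φ)   σ τ =
    cong ∃′ (trans (subst-comp φ (ext σ) (ext τ)) (subst-cong φ (substTm-ext-comp σ τ)))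
  subst-comp (∀′ φ)   σ τ =
    cong ∀′ (trans (subst-comp φ (ext σ) (ext τ)) (subst-cong φ (substTm-ext-comp σ τ)))

  -- φ [ u ] substitutes through an anonymous pattern lambda, which cannot be named in
  -- lemma statements; single u is the same substitution as a named function.
  single : Name κ C → Fin 1 → Tm κ C 0
  single u = con u ∷ []

  []-≡-subst-single : ∀ (φ : Fm κ C 1) u → φ [ u ] ≡ subst φ (single u)
  []-≡-subst-single φ u = subst-cong φ λ { zero → refl }

  subst-ext-single : ∀ {n} (ψ : Fm κ C (sucℕ n)) (θ : Fin n → Tm κ C 1) u w →
                     subst (subst (subst ψ (ext θ)) (ext (single u))) (single w)
                     ≡ subst (subst ψ (con w ∷ θ)) (single u)
  subst-ext-single ψ θ u w = begin
    subst (subst (subst ψ (ext θ)) (ext (single u))) (single w)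
      ≡⟨ cong (λ χ → subst χ (single w)) (subst-comp ψ (ext θ) (ext (single u))) ⟩
    subst (subst ψ _) (single w)
      ≡⟨ subst-comp ψ _ (single w) ⟩
    subst ψ _
      ≡⟨ subst-cong ψ pointwise ⟩
    subst ψ _
      ≡⟨ sym (subst-comp ψ (con w ∷ θ) (single u)) ⟩
    subst (subst ψ (con w ∷ θ)) (single u) ∎
    where
    open ≡-Reasoning
    pointwise : ∀ i → substTm (substTm (ext θ i) (ext (single u))) (single w)
                      ≡ substTm ((con w ∷ θ) i) (single u)
    pointwise zero = refl
    pointwise (sucF j) with θ j
    ... | var zero = refl
    ... | con b    = refl

  instantiate : Tm κ C 1 → Name κ C → Name κ C
  instantiate (var zero) u = u
  instantiate (con b)    u = b

  substTm-single : ∀ (t : Tm κ C 1) u → substTm t (single u) ≡ con (instantiate t u)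
  substTm-single (var zero) u = refl
  substTm-single (con b)    u = refl

  atom-single : ∀ (_◇_ : Tm κ C 0 → Tm κ C 0 → Fm κ C 0) (s t : Tm κ C 1) u →
                con (instantiate s u) ◇ con (instantiate t u)
                ≡ substTm s (single u) ◇ substTm t (single u)
  atom-single _◇_ s t u = sym (cong₂ _◇_ (substTm-single s u) (substTm-single t u))

module CompleteN4Properties {c ℓ ι} (S : CompleteN4 c ℓ ι) where

  open CompleteN4 S
  open IsPartialOrder isPartialOrder public
    using () renaming (refl to ≤-refl; trans to ≤-trans; reflexive to ≤-reflexive)

  infixr 4 _⟫_
  _⟫_ : ∀ {x y z} → x ≤ y → y ≤ z → x ≤ z
  _⟫_ = ≤-trans

  π₁ : ∀ {x y} → x ∧ y ≤ x
  π₁ = ∧-lb₁ _ _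

  π₂ : ∀ {x y} → x ∧ y ≤ y
  π₂ = ∧-lb₂ _ _

  ∧-swap : ∀ {x y} → x ∧ y ≤ y ∧ x
  ∧-swap = ∧-glb π₂ π₁

  modus-ponens : ∀ {x y} → (x ⇒ y) ∧ x ≤ y
  modus-ponens = unresiduate ≤-refl

  ∧-distribˡ-⋁ : ∀ {I : Set ι} x (f : I → Carrier) → x ∧ ⋁ f ≤ ⋁ (λ i → x ∧ f i)
  ∧-distribˡ-⋁ x f =
    ∧-swap ⟫ unresiduate (⋁-lub f λ i → residuate (∧-swap ⟫ ⋁-ub (λ i → x ∧ f i) i))

  ⇒-resp-≡ : ∀ {z p p′ q q′} → p ≡ p′ → q ≡ q′ → z ≤ p ⇒ q → z ≤ p′ ⇒ q′
  ⇒-resp-≡ refl refl z≤p⇒q = z≤p⇒q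

  ∧-mono-⇒ : ∀ {z p p′ q q′} → z ≤ p ⇒ p′ → z ≤ q ⇒ q′ → z ≤ p ∧ q ⇒ p′ ∧ q′
  ∧-mono-⇒ p⇒p′ q⇒q′ = residuate (∧-glb (∧-glb π₁ (π₂ ⟫ π₁) ⟫ unresiduate p⇒p′)
                                        (∧-glb π₁ (π₂ ⟫ π₂) ⟫ unresiduate q⇒q′))

  ∨-mono-⇒ : ∀ {z p p′ q q′} → z ≤ p ⇒ p′ → z ≤ q ⇒ q′ → z ≤ p ∨ q ⇒ p′ ∨ q′
  ∨-mono-⇒ p⇒p′ q⇒q′ = residuate (≤-reflexive (distrib _ _ _) ⟫
    ∨-lub (unresiduate p⇒p′ ⟫ ∨-ub₁ _ _) (unresiduate q⇒q′ ⟫ ∨-ub₂ _ _))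

  ⇒-mono-⇒ : ∀ {z p p′ q q′} → z ≤ p′ ⇒ p → z ≤ q ⇒ q′ → z ≤ (p ⇒ q) ⇒ (p′ ⇒ q′)
  ⇒-mono-⇒ p′⇒p q⇒q′ = residuate (residuate
    (∧-glb (π₁ ⟫ π₁) (∧-glb (π₁ ⟫ π₂) (∧-glb (π₁ ⟫ π₁) π₂ ⟫ unresiduate p′⇒p) ⟫ modus-ponens)
     ⟫ unresiduate q⇒q′))

  ⋁-mono-⇒ : ∀ {I : Set ι} {z} (f g : I → Carrier) →
             (∀ i → z ≤ f i ⇒ g i) → z ≤ ⋁ f ⇒ ⋁ g
  ⋁-mono-⇒ f g f⇒g =
    residuate (∧-distribˡ-⋁ _ f ⟫ ⋁-lub _ λ i → unresiduate (f⇒g i) ⟫ ⋁-ub g i)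

  ⋀-mono-⇒ : ∀ {I : Set ι} {z} (f g : I → Carrier) →
             (∀ i → z ≤ f i ⇒ g i) → z ≤ ⋀ f ⇒ ⋀ g
  ⋀-mono-⇒ f g f⇒g =
    residuate (⋀-glb g λ i → ∧-glb π₁ (π₂ ⟫ ⋀-lb f i) ⟫ unresiduate (f⇒g i))

module TruthValueProperties {c ℓ κ} (S : CompleteN4 c ℓ (c ⊔ suc κ))
                            (T : TruthValueAssignment {κ = κ} S) where

  open CompleteN4 S
  open TruthValueAssignment T
  open CompleteN4Properties S
  open Substitution

  Nm : Set (c ⊔ suc κ)
  Nm = Name κ Carrier

  ⟦_≈_⟧ ⟦_∈_⟧ : Nm → Nm → Carrier
  ⟦ a ≈ b ⟧ = ‖ con a ≈′ con b ‖
  ⟦ a ∈ b ⟧ = ‖ con a ∈′ con b ‖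

  ≈-elimˡ : ∀ a b i → ⟦ a ≈ b ⟧ ≤ val a i ⇒ ⟦ elt a i ∈ b ⟧
  ≈-elimˡ a b i = ≤-reflexive (‖≈‖ a b) ⟫ π₁ ⟫ ⋀-lb _ (lift i)

  ≈-elimʳ : ∀ a b j → ⟦ a ≈ b ⟧ ≤ val b j ⇒ ⟦ elt b j ∈ a ⟧
  ≈-elimʳ a b j = ≤-reflexive (‖≈‖ a b) ⟫ π₂ ⟫ ⋀-lb _ (lift j)

  ≈-intro : ∀ {z} a b → (∀ i → z ≤ val a i ⇒ ⟦ elt a i ∈ b ⟧) →
            (∀ j → z ≤ val b j ⇒ ⟦ elt b j ∈ a ⟧) → z ≤ ⟦ a ≈ b ⟧
  ≈-intro a b ⊆ˡ ⊆ʳ = ∧-glb (⋀-glb _ (⊆ˡ ∘ lower)) (⋀-glb _ (⊆ʳ ∘ lower))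
                      ⟫ ≤-reflexive (sym (‖≈‖ a b))

  ∈-elim : ∀ a b → ⟦ a ∈ b ⟧ ≤ ⋁ λ (j : Lift (c ⊔ suc κ) (Dom b)) →
                                    val b (lower j) ∧ ⟦ elt b (lower j) ≈ a ⟧
  ∈-elim a b = ≤-reflexive (‖∈‖ a b)

  ∈-intro : ∀ a b j → val b j ∧ ⟦ elt b j ≈ a ⟧ ≤ ⟦ a ∈ b ⟧
  ∈-intro a b j = ⋁-ub (λ (j : Lift (c ⊔ suc κ) (Dom b)) →
                         val b (lower j) ∧ ⟦ elt b (lower j) ≈ a ⟧) (lift j)
                  ⟫ ≤-reflexive (sym (‖∈‖ a b))

  ≈-refl : ∀ a → ⊤ ≤ ⟦ a ≈ a ⟧
  ≈-refl a@(mk _ f g) = ≈-intro a a elt∈a elt∈a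
    where
    elt∈a : ∀ i → ⊤ ≤ g i ⇒ ⟦ f i ∈ a ⟧
    elt∈a i = residuate (∧-glb π₂ (⊤-max _ ⟫ ≈-refl (f i)) ⟫ ∈-intro (f i) a i)

  ≈-sym : ∀ a b → ⟦ a ≈ b ⟧ ≤ ⟦ b ≈ a ⟧
  ≈-sym a b = ≈-intro b a (≈-elimʳ a b) (≈-elimˡ a b)

  -- Transitivity is only assumed between elements of b and c, so that ≈-trans can
  -- discharge it by recursion on smaller names.
  ∈-respʳ-≈-by : ∀ x b c →
    (∀ j k → ⟦ elt c k ≈ elt b j ⟧ ∧ ⟦ elt b j ≈ x ⟧ ≤ ⟦ elt c k ≈ x ⟧) →
    ⟦ x ∈ b ⟧ ∧ ⟦ b ≈ c ⟧ ≤ ⟦ x ∈ c ⟧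
  ∈-respʳ-≈-by x b c trans-elt =
    ∧-glb π₂ (π₁ ⟫ ∈-elim x b) ⟫ ∧-distribˡ-⋁ _ _ ⟫ ⋁-lub _ (via ∘ lower)
    where
    via : ∀ j → ⟦ b ≈ c ⟧ ∧ (val b j ∧ ⟦ elt b j ≈ x ⟧) ≤ ⟦ x ∈ c ⟧
    via j = ∧-glb (π₂ ⟫ π₂) (∧-glb (π₁ ⟫ ≈-elimˡ b c j) (π₂ ⟫ π₁) ⟫ modus-ponens ⟫ ∈-elim (elt b j) c)
            ⟫ ∧-distribˡ-⋁ _ _
            ⟫ ⋁-lub _ λ k → ∧-glb (π₂ ⟫ π₁) (∧-glb (π₂ ⟫ π₂) π₁ ⟫ trans-elt j (lower k))
                            ⟫ ∈-intro x c (lower k)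

  ≈-trans : ∀ a b c → ⟦ a ≈ b ⟧ ∧ ⟦ b ≈ c ⟧ ≤ ⟦ a ≈ c ⟧
  ≈-trans a@(mk _ fa ga) b@(mk _ fb _) c@(mk _ fc gc) = ≈-intro a c a⊆c c⊆a
    where
    a⊆c : ∀ i → ⟦ a ≈ b ⟧ ∧ ⟦ b ≈ c ⟧ ≤ ga i ⇒ ⟦ fa i ∈ c ⟧
    a⊆c i = residuate (∧-glb (∧-glb (π₁ ⟫ π₁ ⟫ ≈-elimˡ a b i) π₂ ⟫ modus-ponens) (π₁ ⟫ π₂)
                       ⟫ ∈-respʳ-≈-by (fa i) b c λ j k → ≈-trans (fc k) (fb j) (fa i))
    c⊆a : ∀ k → ⟦ a ≈ b ⟧ ∧ ⟦ b ≈ c ⟧ ≤ gc k ⇒ ⟦ fc k ∈ a ⟧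
    c⊆a k = residuate (∧-glb (∧-glb (π₁ ⟫ π₂ ⟫ ≈-elimʳ b c k) π₂ ⟫ modus-ponens)
                             (π₁ ⟫ π₁ ⟫ ≈-sym a b)
                       ⟫ ∈-respʳ-≈-by (fc k) b a λ j i → ≈-trans (fa i) (fb j) (fc k))

  ∈-respˡ-≈ : ∀ x x′ b → ⟦ x ≈ x′ ⟧ ∧ ⟦ x ∈ b ⟧ ≤ ⟦ x′ ∈ b ⟧
  ∈-respˡ-≈ x x′ b = ∧-glb π₁ (π₂ ⟫ ∈-elim x b) ⟫ ∧-distribˡ-⋁ _ _ ⟫
    ⋁-lub _ λ j → ∧-glb (π₂ ⟫ π₁) (∧-glb (π₂ ⟫ π₂) π₁ ⟫ ≈-trans _ _ _) ⟫ ∈-intro x′ b (lower j)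

  ∈-cong : ∀ {z} a a′ b b′ → z ≤ ⟦ a ≈ a′ ⟧ → z ≤ ⟦ b ≈ b′ ⟧ →
           z ≤ ⟦ a ∈ b ⟧ ⇒ ⟦ a′ ∈ b′ ⟧
  ∈-cong a a′ b b′ a≈a′ b≈b′ = residuate
    (∧-glb (π₁ ⟫ a≈a′) (∧-glb π₂ (π₁ ⟫ b≈b′) ⟫ ∈-respʳ-≈-by a b b′ λ _ _ → ≈-trans _ _ _)
     ⟫ ∈-respˡ-≈ a a′ b′)

  ≈-cong : ∀ {z} a a′ b b′ → z ≤ ⟦ a ≈ a′ ⟧ → z ≤ ⟦ b ≈ b′ ⟧ →
           z ≤ ⟦ a ≈ b ⟧ ⇒ ⟦ a′ ≈ b′ ⟧
  ≈-cong a a′ b b′ a≈a′ b≈b′ = residuate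
    (∧-glb (∧-glb (π₁ ⟫ a≈a′ ⟫ ≈-sym a a′) π₂ ⟫ ≈-trans _ _ _) (π₁ ⟫ b≈b′) ⟫ ≈-trans _ _ _)

  instantiate-≈ : ∀ (t : Tm κ Carrier 1) u v →
                  ⟦ u ≈ v ⟧ ≤ ⟦ instantiate t u ≈ instantiate t v ⟧
  instantiate-≈ (var zero) u v = ≤-refl
  instantiate-≈ (con b)    u v = ⊤-max _ ⟫ ≈-refl b

  under-binder : ∀ {n} (ψ : Fm κ Carrier (sucℕ n)) (θ : Fin n → Tm κ Carrier 1) u w →
                 ‖ subst (subst ψ (con w ∷ θ)) (single u) ‖
                 ≡ ‖ subst (subst ψ (ext θ)) (ext (single u)) [ w ] ‖
  under-binder ψ θ u w = cong ‖_‖ (trans (sym (subst-ext-single ψ θ u w))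
                                         (sym ([]-≡-subst-single _ w)))

  leibniz-subst : ∀ {n} (φ : Fm κ Carrier n) (θ : Fin n → Tm κ Carrier 1) u v →
    ⟦ u ≈ v ⟧ ≤ ‖ subst (subst φ θ) (single u) ‖ ⇒ ‖ subst (subst φ θ) (single v) ‖
  leibniz-subst (s ∈′ t) θ u v =
    ⇒-resp-≡ (cong ‖_‖ (atom-single _∈′_ (substTm s θ) (substTm t θ) u))
             (cong ‖_‖ (atom-single _∈′_ (substTm s θ) (substTm t θ) v))
             (∈-cong _ _ _ _ (instantiate-≈ (substTm s θ) u v) (instantiate-≈ (substTm t θ) u v))
  leibniz-subst (s ≈′ t) θ u v =
    ⇒-resp-≡ (cong ‖_‖ (atom-single _≈′_ (substTm s θ) (substTm t θ) u))
             (cong ‖_‖ (atom-single _≈′_ (substTm s θ) (substTm t θ) v))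
             (≈-cong _ _ _ _ (instantiate-≈ (substTm s θ) u v) (instantiate-≈ (substTm t θ) u v))
  leibniz-subst (φ ∧′ ψ) θ u v = ⇒-resp-≡ (sym (‖∧‖ _ _)) (sym (‖∧‖ _ _))
    (∧-mono-⇒ (leibniz-subst φ θ u v) (leibniz-subst ψ θ u v))
  leibniz-subst (φ ∨′ ψ) θ u v = ⇒-resp-≡ (sym (‖∨‖ _ _)) (sym (‖∨‖ _ _))
    (∨-mono-⇒ (leibniz-subst φ θ u v) (leibniz-subst ψ θ u v))
  leibniz-subst (φ ⇒′ ψ) θ u v = ⇒-resp-≡ (sym (‖⇒‖ _ _)) (sym (‖⇒‖ _ _))
    (⇒-mono-⇒ (≈-sym u v ⟫ leibniz-subst φ θ v u) (leibniz-subst ψ θ u v))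
  leibniz-subst (¬′ ψ) θ u v = ⇒-resp-≡ (negated u) (negated v) (‖¬‖-leibniz u v (subst ψ θ))
    where
    negated : ∀ w → ‖ ¬′ (subst ψ θ [ w ]) ‖ ≡ ‖ ¬′ subst (subst ψ θ) (single w) ‖
    negated w = cong (‖_‖ ∘ ¬′_) ([]-≡-subst-single (subst ψ θ) w)
  leibniz-subst (∃′ ψ) θ u v = ⇒-resp-≡ (sym (‖∃‖ _)) (sym (‖∃‖ _))
    (⋁-mono-⇒ _ _ λ w → ⇒-resp-≡ (under-binder ψ θ u w) (under-binder ψ θ v w)
                                  (leibniz-subst ψ (con w ∷ θ) u v))
  leibniz-subst (∀′ ψ) θ u v = ⇒-resp-≡ (sym (‖∀‖ _)) (sym (‖∀‖ _))
    (⋀-mono-⇒ _ _ λ w → ⇒-resp-≡ (under-binder ψ θ u w) (under-binder ψ θ v w)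
                                  (leibniz-subst ψ (con w ∷ θ) u v))

  leibniz : ∀ u v (φ : Fm κ Carrier 1) → ⟦ u ≈ v ⟧ ≤ ‖ φ [ u ] ‖ ⇒ ‖ φ [ v ] ‖
  leibniz u v φ = ⇒-resp-≡ (closing u) (closing v) (leibniz-subst φ var u v)
    where
    closing : ∀ w → ‖ subst (subst φ var) (single w) ‖ ≡ ‖ φ [ w ] ‖
    closing w = cong ‖_‖ (trans (subst-comp φ var (single w)) (sym ([]-≡-subst-single φ w)))

mainTheorem5 : ∀ {c ℓ κ : Level} (S : CompleteN4 c ℓ (c ⊔ suc κ))
                 (T : TruthValueAssignment S)
                 (u v : Name κ (CompleteN4.Carrier S))
                 (φ : Fm κ (CompleteN4.Carrier S) 1) →
                 CompleteN4._≤_ S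
                   (TruthValueAssignment.‖_‖ T (con u ≈′ con v))
                   (CompleteN4._⇒_ S (TruthValueAssignment.‖_‖ T (φ [ u ]))
                                     (TruthValueAssignment.‖_‖ T (φ [ v ])))
mainTheorem5 S T = TruthValueProperties.leibniz S T
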